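{- Define $\widehat{G}_n(w,x,z)$ and $\check{G}_n(w,x,z)$ by the recursions $$\widehat{G}_1(w,x,z)=\check{G}_1(w,x,z)=\frac{1}{1-w},$$ and, for $n\ge 2$, $$\widehat{G}_n(w,x,z)=\sum_{k=1}^{n-1}\frac{\widehat{G}_{k}(w,x,z)\,\widehat{G}_{n-k}(w+kz,x,z)}{1-w-(n-1)x},$$ $$\check{G}_n(w,x,z)=\sum_{k=1}^{n-1}\frac{\check{G}_{k}(w+x,x,z)\,\check{G}_{n-k}(w+kz,x,z)}{1-w}.$$ Then $\widehat{G}_n(w,x,z)=\check{G}_n(w,x,z)$ for all $n\ge 1$.
   Context: The functions are rational functions in formal variables $w,x,z$. (In the paper the second family is written with an inverted-hat accent, denoted here by $\check{G}_n$.) By a result of Janson, this identity is equivalent to the statement that for depth-first search in a random multidigraph on $n$ vertices with independent geometric outdegrees (mode $0$, mean $p/(1-p)$) and uniform random arc endpoints, with $L,F,B,C,T$ the numbers of loops, forward, back, cross and tree arcs, $(L,F,B+C,T)$ and $(L,B,F+C,T)$ have the same distribution; in particular $F$ and $B$ have the same distribution (Knuth's conjecture). -}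

module Defs where

open import Data.Nat as ℕ using (ℕ; zero; suc)
open import Data.Integer using (+_)
open import Data.Rational using (ℚ; 0ℚ; 1ℚ; _+_; _*_; _-_; _/_)
open import Data.Product using (_×_; _,_)
open import Relation.Binary.PropositionalEquality using (_≡_)

-- Rational functions in w,x,z over ℚ are represented by a pair
-- (numerator , denominator) of polynomial functions, evaluated at a point
-- (w , x , z) ∈ ℚ³.  A pair (a , b) stands for the fraction a / b.
-- Since ℚ is infinite, two polynomials agree as formal polynomials iff
-- they agree at every rational point.

Frac : Set
Frac = ℚ × ℚ

ℕ→ℚ : ℕ → ℚ
ℕ→ℚ k = + k / 1

fzero : Frac
fzero = 0ℚ , 1ℚ

_⊕_ : Frac → Frac → Frac
(a , b) ⊕ (c , d) = (a * d + c * b) , (b * d)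

_⊗_ : Frac → Frac → Frac
(a , b) ⊗ (c , d) = (a * c) , (b * d)

_⊘_ : Frac → ℚ → Frac
(a , b) ⊘ q = a , (b * q)

sumFrom1 : ℕ → (ℕ → Frac) → Frac
sumFrom1 zero    f = fzero
sumFrom1 (suc m) f = sumFrom1 m f ⊕ f (suc m)

-- Ĝ with fuel (fuel ≥ n suffices; the recursion only calls indices < n)
Ĝaux : ℕ → ℕ → ℚ → ℚ → ℚ → Frac
Ĝaux zero     n w x z = fzero
Ĝaux (suc f)  zero w x z = fzero
Ĝaux (suc f)  (suc zero) w x z = 1ℚ , (1ℚ - w)
Ĝaux (suc f)  (suc (suc m)) w x z =
  sumFrom1 (suc m)
    (λ k → Ĝaux f k w x z ⊗ Ĝaux f (suc (suc m) ℕ.∸ k) (w + ℕ→ℚ k * z) x z)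
  ⊘ (1ℚ - w - ℕ→ℚ (suc m) * x)

Ǧaux : ℕ → ℕ → ℚ → ℚ → ℚ → Frac
Ǧaux zero     n w x z = fzero
Ǧaux (suc f)  zero w x z = fzero
Ǧaux (suc f)  (suc zero) w x z = 1ℚ , (1ℚ - w)
Ǧaux (suc f)  (suc (suc m)) w x z =
  sumFrom1 (suc m)
    (λ k → Ǧaux f k (w + x) x z ⊗ Ǧaux f (suc (suc m) ℕ.∸ k) (w + ℕ→ℚ k * z) x z)
  ⊘ (1ℚ - w)

Ĝ : ℕ → ℚ → ℚ → ℚ → Frac
Ĝ n = Ĝaux n n

Ǧ : ℕ → ℚ → ℚ → ℚ → Frac
Ǧ n = Ǧaux n n

_≈F_ : Frac → Frac → Set
(a , b) ≈F (c , d) = a * d ≡ c * b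

{-# OPTIONS --safe #-}
-- Away from the zeros of h w q d = 1 − w − d x − q z, both Ĝₙ and Ǧₙ equal W w (n − 1) 0,
-- where W w q d sums, over lattice paths from (0,0) to (q,d) with steps (0,1) and (1,−1)
-- staying in d ≥ 0, the product of 1 / h over the visited points.  An induction over the
-- lattice shows, for u = w + x with ℓ ≡ 1 − w and for u = w with ℓ p = 1 − w − p x,
--   ℓ (d + q) · W w q d = [q = d = 0] + W u q (d − 1) + Σ_{k+j=q−1} W u k 0 · W (w + (k+1) z) j d;
-- at d = 0 this is the recursion of Ǧ, resp. Ĝ.  If h vanishes somewhere in the triangle
-- d + q ≤ n − 1, the denominators of Ĝₙ and Ǧₙ both vanish and the cross-multiplied
-- equation is trivial.
module Submission where

open import Defs
open import Data.Nat using (ℕ; _≤_)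
open import Data.Rational using (ℚ)
open import Data.Nat as ℕ using (zero; suc; z≤n; s≤s; _∸_)
import Data.Nat.Properties as ℕP
import Data.Integer as ℤ
import Data.Integer.Properties as ℤP
open import Data.Rational using (0ℚ; 1ℚ; _+_; _*_; _-_; -_; 1/_; ≢-nonZero; toℚᵘ)
open import Data.Rational.Properties
  using (_≟_; toℚᵘ-injective; toℚᵘ-fromℚᵘ; toℚᵘ-homo-+; *-inverseʳ; *-assoc; *-comm;
         *-identityˡ; *-identityʳ; *-zeroˡ; *-zeroʳ; +-identityˡ; +-identityʳ)
import Data.Rational.Unnormalised as ℚᵘ
import Data.Rational.Unnormalised.Properties as ℚᵘP
open import Data.Rational.Solver using (module +-*-Solver)
open import Data.Product using (_×_; _,_; proj₁; proj₂; ∃-syntax)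
open import Data.Sum using (_⊎_; inj₁; inj₂)
open import Relation.Binary.PropositionalEquality
open import Relation.Nullary using (yes; no; contradiction)
open import Function using (_$_)
open import Algebra.Properties.CommutativeSemigroup ℕP.+-commutativeSemigroup using (x∙yz≈y∙xz)

open +-*-Solver

ℕ→ℚ-+ : ∀ m n → ℕ→ℚ (m ℕ.+ n) ≡ ℕ→ℚ m + ℕ→ℚ n
ℕ→ℚ-+ m n = toℚᵘ-injective (begin
  toℚᵘ (ℕ→ℚ (m ℕ.+ n))                     ≈⟨ toℚᵘ-fromℚᵘ (ℚᵘ.mkℚᵘ (ℤ.+ (m ℕ.+ n)) 0) ⟩
  ℚᵘ.mkℚᵘ (ℤ.+ (m ℕ.+ n)) 0                 ≈⟨ ℚᵘP.≃-reflexive (cong (λ i → ℚᵘ.mkℚᵘ i 0) numerator) ⟩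
  ℚᵘ.mkℚᵘ (ℤ.+ m) 0 ℚᵘ.+ ℚᵘ.mkℚᵘ (ℤ.+ n) 0  ≈⟨ ℚᵘP.+-cong (toℚᵘ-fromℚᵘ (ℚᵘ.mkℚᵘ (ℤ.+ m) 0))
                                                           (toℚᵘ-fromℚᵘ (ℚᵘ.mkℚᵘ (ℤ.+ n) 0)) ⟨
  toℚᵘ (ℕ→ℚ m) ℚᵘ.+ toℚᵘ (ℕ→ℚ n)            ≈⟨ toℚᵘ-homo-+ (ℕ→ℚ m) (ℕ→ℚ n) ⟨
  toℚᵘ (ℕ→ℚ m + ℕ→ℚ n)                      ∎)
  where
  open ℚᵘP.≃-Reasoning
  numerator : ℤ.+ (m ℕ.+ n) ≡ ℤ.+ m ℤ.* ℤ.+ 1 ℤ.+ ℤ.+ n ℤ.* ℤ.+ 1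
  numerator = trans (ℤP.pos-+ m n) (sym (cong₂ ℤ._+_ (ℤP.*-identityʳ (ℤ.+ m)) (ℤP.*-identityʳ (ℤ.+ n))))

open ≡-Reasoning

inv : ℚ → ℚ
inv q with q ≟ 0ℚ
... | yes _   = 0ℚ
... | no q≢0 = 1/_ q {{≢-nonZero q≢0}}

*-inv : ∀ q → q ≢ 0ℚ → q * inv q ≡ 1ℚ
*-inv q q≢0 with q ≟ 0ℚ
... | yes q≡0  = contradiction q≡0 q≢0
... | no q≢0′ = *-inverseʳ q {{≢-nonZero q≢0′}}

*-inv-cancelˡ : ∀ c a → c ≢ 0ℚ → c * (inv c * a) ≡ a
*-inv-cancelˡ c a c≢0 = begin
  c * (inv c * a)  ≡⟨ *-assoc c (inv c) a ⟨
  c * inv c * a    ≡⟨ cong (_* a) (*-inv c c≢0) ⟩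
  1ℚ * a           ≡⟨ *-identityˡ a ⟩
  a                ∎

*-cancelˡ : ∀ c {a b} → c ≢ 0ℚ → c * a ≡ c * b → a ≡ b
*-cancelˡ c {a} {b} c≢0 ca≡cb = begin
  a                ≡⟨ *-inv-cancelˡ c a c≢0 ⟨
  c * (inv c * a)  ≡⟨ leftComm c (inv c) a ⟩
  inv c * (c * a)  ≡⟨ cong (inv c *_) ca≡cb ⟩
  inv c * (c * b)  ≡⟨ leftComm (inv c) c b ⟩
  c * (inv c * b)  ≡⟨ *-inv-cancelˡ c b c≢0 ⟩
  b                ∎
  where
  leftComm : ∀ p q r → p * (q * r) ≡ q * (p * r)
  leftComm = solve 3 (λ p q r → p :* (q :* r) := q :* (p :* r)) refl

*-vanishesˡ : ∀ {a} b → a ≡ 0ℚ → a * b ≡ 0ℚ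
*-vanishesˡ b refl = *-zeroˡ b

*-vanishesʳ : ∀ a {b} → b ≡ 0ℚ → a * b ≡ 0ℚ
*-vanishesʳ a refl = *-zeroʳ a

den : Frac → ℚ
den = proj₂

record _represents_ (F : Frac) (v : ℚ) : Set where
  constructor cross-multiplied
  field numerator≡ : proj₁ F ≡ v * den F

⊕-represents : ∀ {F G u v} → F represents u → G represents v → (F ⊕ G) represents (u + v)
⊕-represents {_ , b} {_ , d} {u} {v} (cross-multiplied refl) (cross-multiplied refl) = cross-multiplied $
  solve 4 (λ u b v d → u :* b :* d :+ v :* d :* b := (u :+ v) :* (b :* d)) refl u b v d

⊗-represents : ∀ {F G u v} → F represents u → G represents v → (F ⊗ G) represents (u * v)
⊗-represents {_ , b} {_ , d} {u} {v} (cross-multiplied refl) (cross-multiplied refl) = cross-multiplied $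
  solve 4 (λ u b v d → u :* b :* (v :* d) := u :* v :* (b :* d)) refl u b v d

⊘-represents : ∀ {F} q {v v′} → F represents v → q * v′ ≡ v → (F ⊘ q) represents v′
⊘-represents {_ , b} q {v′ = v′} (cross-multiplied refl) refl = cross-multiplied $
  solve 3 (λ q v′ b → q :* v′ :* b := v′ :* (b :* q)) refl q v′ b

represents-≈F : ∀ {F G v} → F represents v → G represents v → F ≈F G
represents-≈F {_ , b} {_ , d} {v} (cross-multiplied refl) (cross-multiplied refl) =
  solve 3 (λ v b d → v :* b :* d := v :* d :* b) refl v b d

den-vanishes-≈F : ∀ F G → den F ≡ 0ℚ → den G ≡ 0ℚ → F ≈F G
den-vanishes-≈F (a , _) (c , _) refl refl = trans (*-zeroʳ a) (sym (*-zeroʳ c))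

≈F-by-nondegeneracy : ∀ {P : Set} {v} F G →
  (den F ≢ 0ℚ → P) → (den G ≢ 0ℚ → P) → (P → F represents v) → (P → G represents v) → F ≈F G
≈F-by-nondegeneracy F G F-P G-P P-F P-G with den F ≟ 0ℚ | den G ≟ 0ℚ
... | yes F≡0 | yes G≡0 = den-vanishes-≈F F G F≡0 G≡0
... | no F≢0  | _       = represents-≈F (P-F (F-P F≢0)) (P-G (F-P F≢0))
... | yes _   | no G≢0  = represents-≈F (P-F (G-P G≢0)) (P-G (G-P G≢0))

sumFrom1ℚ : ℕ → (ℕ → ℚ) → ℚ
sumFrom1ℚ zero    f = 0ℚ
sumFrom1ℚ (suc m) f = sumFrom1ℚ m f + f (suc m)

sumFrom1-represents : ∀ M (F : ℕ → Frac) (v : ℕ → ℚ) →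
  (∀ k → 1 ≤ k → k ≤ M → F k represents v k) → sumFrom1 M F represents sumFrom1ℚ M v
sumFrom1-represents zero    F v Fv = cross-multiplied refl
sumFrom1-represents (suc m) F v Fv =
  ⊕-represents
    (sumFrom1-represents m F v (λ k 1≤k k≤m → Fv k 1≤k (ℕP.m≤n⇒m≤1+n k≤m)))
    (Fv (suc m) (s≤s z≤n) ℕP.≤-refl)

sumFrom1-den-vanishes : ∀ M (F : ℕ → Frac) k → 1 ≤ k → k ≤ M →
  den (F k) ≡ 0ℚ → den (sumFrom1 M F) ≡ 0ℚ
sumFrom1-den-vanishes zero    F _ (s≤s _) () _
sumFrom1-den-vanishes (suc m) F k 1≤k k≤1+m Fk≡0 with ℕP.m≤n⇒m<n∨m≡n k≤1+m
... | inj₁ (s≤s k≤m) =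
  *-vanishesˡ (den (F (suc m))) (sumFrom1-den-vanishes m F k 1≤k k≤m Fk≡0)
... | inj₂ refl = *-vanishesʳ (den (sumFrom1 m F)) Fk≡0

antidiagonalSum : ℕ → (ℕ → ℕ → ℚ) → ℚ
antidiagonalSum zero    T = T 0 0
antidiagonalSum (suc n) T = antidiagonalSum n (λ k j → T k (suc j)) + T (suc n) 0

antidiagonalSum-cong : ∀ n {T T′ : ℕ → ℕ → ℚ} →
  (∀ k j → k ℕ.+ j ≡ n → T k j ≡ T′ k j) → antidiagonalSum n T ≡ antidiagonalSum n T′
antidiagonalSum-cong zero    T≡T′ = T≡T′ 0 0 refl
antidiagonalSum-cong (suc n) T≡T′ = cong₂ _+_
  (antidiagonalSum-cong n (λ k j k+j≡n → T≡T′ k (suc j) (trans (ℕP.+-suc k j) (cong suc k+j≡n))))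
  (T≡T′ (suc n) 0 (ℕP.+-identityʳ (suc n)))

antidiagonalSum-+ : ∀ n (T T′ : ℕ → ℕ → ℚ) →
  antidiagonalSum n (λ k j → T k j + T′ k j) ≡ antidiagonalSum n T + antidiagonalSum n T′
antidiagonalSum-+ zero    T T′ = refl
antidiagonalSum-+ (suc n) T T′ = trans
  (cong (_+ (T (suc n) 0 + T′ (suc n) 0)) (antidiagonalSum-+ n (λ k j → T k (suc j)) (λ k j → T′ k (suc j))))
  (solve 4 (λ a b c d → (a :+ b) :+ (c :+ d) := (a :+ c) :+ (b :+ d)) refl
    (antidiagonalSum n (λ k j → T k (suc j))) (antidiagonalSum n (λ k j → T′ k (suc j))) (T (suc n) 0) (T′ (suc n) 0))

antidiagonalSum-*ˡ : ∀ n c (T : ℕ → ℕ → ℚ) → antidiagonalSum n (λ k j → c * T k j) ≡ c * antidiagonalSum n T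
antidiagonalSum-*ˡ zero    c T = refl
antidiagonalSum-*ˡ (suc n) c T = trans
  (cong (_+ c * T (suc n) 0) (antidiagonalSum-*ˡ n c (λ k j → T k (suc j))))
  (solve 3 (λ c a b → c :* a :+ c :* b := c :* (a :+ b)) refl c _ _)

antidiagonalSum-vanishes : ∀ n {T : ℕ → ℕ → ℚ} → (∀ k j → T k j ≡ 0ℚ) → antidiagonalSum n T ≡ 0ℚ
antidiagonalSum-vanishes zero    T≡0 = T≡0 0 0
antidiagonalSum-vanishes (suc n) T≡0 =
  cong₂ _+_ (antidiagonalSum-vanishes n (λ k j → T≡0 k (suc j))) (T≡0 (suc n) 0)

antidiagonalSum-last : ∀ n {T : ℕ → ℕ → ℚ} → (∀ k j → T k (suc j) ≡ 0ℚ) → antidiagonalSum n T ≡ T n 0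
antidiagonalSum-last zero    T≡0 = refl
antidiagonalSum-last (suc n) {T} T≡0 =
  trans (cong (_+ T (suc n) 0) (antidiagonalSum-vanishes n T≡0)) (+-identityˡ (T (suc n) 0))

sumFrom1ℚ-antidiagonal : ∀ m (T : ℕ → ℕ → ℚ) →
  sumFrom1ℚ (suc m) (λ k → T k (suc m ∸ k)) ≡ antidiagonalSum m (λ k j → T (suc k) j)
sumFrom1ℚ-antidiagonal zero    T = +-identityˡ (T 1 0)
sumFrom1ℚ-antidiagonal (suc m) T = cong₂ _+_
  (trans (sumFrom1ℚ-cong (suc m) (λ k _ k≤1+m → cong (T k) (ℕP.+-∸-assoc 1 k≤1+m)))
         (sumFrom1ℚ-antidiagonal m (λ k j → T k (suc j))))
  (cong (T (suc (suc m))) (ℕP.n∸n≡0 m))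
  where
  sumFrom1ℚ-cong : ∀ M {f g : ℕ → ℚ} → (∀ k → 1 ≤ k → k ≤ M → f k ≡ g k) → sumFrom1ℚ M f ≡ sumFrom1ℚ M g
  sumFrom1ℚ-cong zero    f≡g = refl
  sumFrom1ℚ-cong (suc M) f≡g =
    cong₂ _+_ (sumFrom1ℚ-cong M (λ k 1≤k k≤M → f≡g k 1≤k (ℕP.m≤n⇒m≤1+n k≤M))) (f≡g (suc M) (s≤s z≤n) ℕP.≤-refl)

module LatticePaths (x z : ℚ) where

  h : ℚ → ℕ → ℕ → ℚ
  h w q d = 1ℚ - w - ℕ→ℚ d * x - ℕ→ℚ q * z

  h-axis : ∀ w d → h w 0 d ≡ 1ℚ - w - ℕ→ℚ d * x
  h-axis w d = solve 4 (λ w x z n → con 1ℚ :- w :- n :* x :- con 0ℚ :* z := con 1ℚ :- w :- n :* x) refl w x z (ℕ→ℚ d)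

  h-origin : ∀ w → h w 0 0 ≡ 1ℚ - w
  h-origin w = trans (h-axis w 0) (solve 2 (λ w x → con 1ℚ :- w :- con 0ℚ :* x := con 1ℚ :- w) refl w x)

  h-+x : ∀ w q d → h (w + x) q d ≡ h w q (suc d)
  h-+x w q d = trans
    (solve 5 (λ w x z d q → con 1ℚ :- (w :+ x) :- d :* x :- q :* z := con 1ℚ :- w :- (con 1ℚ :+ d) :* x :- q :* z)
      refl w x z (ℕ→ℚ d) (ℕ→ℚ q))
    (cong (λ t → 1ℚ - w - t * x - ℕ→ℚ q * z) (sym (ℕ→ℚ-+ 1 d)))

  h-+z : ∀ w k q d → h (w + ℕ→ℚ k * z) q d ≡ h w (k ℕ.+ q) d
  h-+z w k q d = trans
    (solve 6 (λ w x z d q k → con 1ℚ :- (w :+ k :* z) :- d :* x :- q :* z := con 1ℚ :- w :- d :* x :- (k :+ q) :* z)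
      refl w x z (ℕ→ℚ d) (ℕ→ℚ q) (ℕ→ℚ k))
    (cong (λ t → 1ℚ - w - ℕ→ℚ d * x - t * z) (sym (ℕ→ℚ-+ k q)))

  h-suc-d : ∀ w q d → h w q (suc d) - h w q d ≡ - x
  h-suc-d w q d = trans
    (cong (λ t → 1ℚ - w - t * x - ℕ→ℚ q * z - h w q d) (ℕ→ℚ-+ 1 d))
    (solve 5 (λ w x z d q →
       (con 1ℚ :- w :- (con 1ℚ :+ d) :* x :- q :* z) :- (con 1ℚ :- w :- d :* x :- q :* z) := :- x)
      refl w x z (ℕ→ℚ d) (ℕ→ℚ q))

  Nondegenerate : ℚ → ℕ → Set
  Nondegenerate w N = ∀ q d → d ℕ.+ q ≤ N → h w q d ≢ 0ℚ

  Nondegenerate-mono : ∀ {w M N} → M ≤ N → Nondegenerate w N → Nondegenerate w M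
  Nondegenerate-mono M≤N nz q d b = nz q d (ℕP.≤-trans b M≤N)

  Nondegenerate-+x : ∀ w N → Nondegenerate w (suc N) → Nondegenerate (w + x) N
  Nondegenerate-+x w N nz q d b hq≡0 = nz q (suc d) (s≤s b) (trans (sym (h-+x w q d)) hq≡0)

  Nondegenerate-+z : ∀ w N k j → k ℕ.+ j ≤ N → Nondegenerate w N → Nondegenerate (w + ℕ→ℚ k * z) j
  Nondegenerate-+z w N k j k+j≤N nz q d d+q≤j hq≡0 =
    nz (k ℕ.+ q) d
       (ℕP.≤-trans (ℕP.≤-reflexive (x∙yz≈y∙xz d k q)) (ℕP.≤-trans (ℕP.+-monoʳ-≤ k d+q≤j) k+j≤N))
       (trans (sym (h-+z w k q d)) hq≡0)

  -- Matching on d first makes δ₀ q (suc d) reduce to 0ℚ for a variable q.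
  δ₀ : ℕ → ℕ → ℚ
  δ₀ _       (suc _) = 0ℚ
  δ₀ zero    zero    = 1ℚ
  δ₀ (suc _) zero    = 0ℚ

  -- W↑ and W↘ are the contributions of paths whose last step is (0,1), resp. (1,−1).
  mutual
    W : ℚ → ℕ → ℕ → ℚ
    W w q d = inv (h w q d) * (δ₀ q d + W↑ w q d + W↘ w q d)

    W↑ : ℚ → ℕ → ℕ → ℚ
    W↑ w q zero    = 0ℚ
    W↑ w q (suc d) = W w q d

    W↘ : ℚ → ℕ → ℕ → ℚ
    W↘ w zero    d = 0ℚ
    W↘ w (suc q) d = W w q (suc d)

  W-recurrence : ∀ w q d → h w q d ≢ 0ℚ → h w q d * W w q d ≡ δ₀ q d + W↑ w q d + W↘ w q d
  W-recurrence w q d hq≢0 = *-inv-cancelˡ (h w q d) _ hq≢0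

  W-recurrence-scaled : ∀ c w q d → h w q d ≢ 0ℚ →
    h w q d * (c * W w q d) ≡ c * (δ₀ q d + W↑ w q d + W↘ w q d)
  W-recurrence-scaled c w q d hq≢0 = begin
    h w q d * (c * W w q d)  ≡⟨ solve 3 (λ h c W → h :* (c :* W) := c :* (h :* W)) refl (h w q d) c (W w q d) ⟩
    c * (h w q d * W w q d)  ≡⟨ cong (c *_) (W-recurrence w q d hq≢0) ⟩
    c * (δ₀ q d + W↑ w q d + W↘ w q d) ∎

  W-origin : ∀ w → h w 0 0 ≢ 0ℚ → 1ℚ ≡ W w 0 0 * (1ℚ - w)
  W-origin w h≢0 = begin
    1ℚ                  ≡⟨ W-recurrence w 0 0 h≢0 ⟨
    h w 0 0 * W w 0 0   ≡⟨ cong (_* W w 0 0) (h-origin w) ⟩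
    (1ℚ - w) * W w 0 0  ≡⟨ *-comm (1ℚ - w) (W w 0 0) ⟩
    W w 0 0 * (1ℚ - w)  ∎

  conv : ℚ → ℚ → ℕ → ℕ → ℚ
  conv u w zero    d = 0ℚ
  conv u w (suc q) d = antidiagonalSum q (λ k j → W u k 0 * W (w + ℕ→ℚ (suc k) * z) j d)

  conv-recurrence : ∀ u w q d → h w (suc q) d ≢ 0ℚ →
    h w (suc q) d * conv u w (suc q) d
      ≡ antidiagonalSum q (λ k j → W u k 0 * δ₀ j d)
        + antidiagonalSum q (λ k j → W u k 0 * W↑ (w + ℕ→ℚ (suc k) * z) j d)
        + antidiagonalSum q (λ k j → W u k 0 * W↘ (w + ℕ→ℚ (suc k) * z) j d)
  conv-recurrence u w q d H≢0 = begin
    H * antidiagonalSum q T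
      ≡⟨ antidiagonalSum-*ˡ q H T ⟨
    antidiagonalSum q (λ k j → H * T k j)
      ≡⟨ antidiagonalSum-cong q distribute ⟩
    antidiagonalSum q (λ k j → (A k * δ₀ j d + A k * W↑ (w′ k) j d) + A k * W↘ (w′ k) j d)
      ≡⟨ antidiagonalSum-+ q (λ k j → A k * δ₀ j d + A k * W↑ (w′ k) j d) (λ k j → A k * W↘ (w′ k) j d) ⟩
    antidiagonalSum q (λ k j → A k * δ₀ j d + A k * W↑ (w′ k) j d) + antidiagonalSum q (λ k j → A k * W↘ (w′ k) j d)
      ≡⟨ cong (_+ antidiagonalSum q (λ k j → A k * W↘ (w′ k) j d))
              (antidiagonalSum-+ q (λ k j → A k * δ₀ j d) (λ k j → A k * W↑ (w′ k) j d)) ⟩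
    antidiagonalSum q (λ k j → A k * δ₀ j d) + antidiagonalSum q (λ k j → A k * W↑ (w′ k) j d)
      + antidiagonalSum q (λ k j → A k * W↘ (w′ k) j d) ∎
    where
    H = h w (suc q) d
    A = λ k → W u k 0
    w′ = λ k → w + ℕ→ℚ (suc k) * z
    T = λ k j → A k * W (w′ k) j d
    distribute : ∀ k j → k ℕ.+ j ≡ q → H * T k j ≡ (A k * δ₀ j d + A k * W↑ (w′ k) j d) + A k * W↘ (w′ k) j d
    distribute k j k+j≡q = begin
      H * (A k * W (w′ k) j d)
        ≡⟨ solve 3 (λ H A W → H :* (A :* W) := A :* (H :* W)) refl H (A k) (W (w′ k) j d) ⟩
      A k * (H * W (w′ k) j d)
        ≡⟨ cong (λ t → A k * (t * W (w′ k) j d)) (sym hk≡H) ⟩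
      A k * (h (w′ k) j d * W (w′ k) j d)
        ≡⟨ cong (A k *_) (W-recurrence (w′ k) j d (λ hk≡0 → H≢0 (trans (sym hk≡H) hk≡0))) ⟩
      A k * (δ₀ j d + W↑ (w′ k) j d + W↘ (w′ k) j d)
        ≡⟨ solve 4 (λ A a b c → A :* (a :+ b :+ c) := A :* a :+ A :* b :+ A :* c)
             refl (A k) (δ₀ j d) (W↑ (w′ k) j d) (W↘ (w′ k) j d) ⟩
      (A k * δ₀ j d + A k * W↑ (w′ k) j d) + A k * W↘ (w′ k) j d ∎
      where
      hk≡H : h (w′ k) j d ≡ H
      hk≡H = trans (h-+z w (suc k) j d) (cong (λ p → h w (suc p) d) k+j≡q)

  conv-↘ : ∀ u w q d → antidiagonalSum q (λ k j → W u k 0 * W↘ (w + ℕ→ℚ (suc k) * z) j d) ≡ conv u w q (suc d)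
  conv-↘ u w zero    d = *-zeroʳ (W u 0 0)
  conv-↘ u w (suc q) d =
    trans (cong (conv u w (suc q) (suc d) +_) (*-zeroʳ (W u (suc q) 0))) (+-identityʳ (conv u w (suc q) (suc d)))

  conv-recurrence-zero : ∀ u w q → h w (suc q) 0 ≢ 0ℚ →
    h w (suc q) 0 * conv u w (suc q) 0 ≡ W u q 0 + conv u w q 1
  conv-recurrence-zero u w q H≢0 = trans (conv-recurrence u w q 0 H≢0)
    (cong₂ _+_
      (trans (cong₂ _+_ (trans (antidiagonalSum-last q (λ k _ → *-zeroʳ (W u k 0))) (*-identityʳ (W u q 0)))
                        (antidiagonalSum-vanishes q (λ k _ → *-zeroʳ (W u k 0))))
             (+-identityʳ (W u q 0)))
      (conv-↘ u w q 0))

  conv-recurrence-suc : ∀ u w q d → h w (suc q) (suc d) ≢ 0ℚ →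
    h w (suc q) (suc d) * conv u w (suc q) (suc d) ≡ conv u w (suc q) d + conv u w q (suc (suc d))
  conv-recurrence-suc u w q d H≢0 = trans (conv-recurrence u w q (suc d) H≢0)
    (cong₂ _+_
      (trans (cong (_+ conv u w (suc q) d) (antidiagonalSum-vanishes q (λ k _ → *-zeroʳ (W u k 0))))
             (+-identityˡ (conv u w (suc q) d)))
      (conv-↘ u w q (suc d)))

  module ConvolutionIdentity
    (u w : ℚ) (ℓ : ℕ → ℚ) (N : ℕ)
    (ℓ-origin : ℓ 0 ≡ h w 0 0)
    (ℓ-step : ∀ q d → (ℓ (suc (d ℕ.+ q)) - ℓ (d ℕ.+ q)) * W w q d ≡ (h w q (suc d) - h u q d) * W u q d)
    (nz-w : Nondegenerate w N)
    (nz-u : ∀ q d → suc (d ℕ.+ q) ≤ N → h u q d ≢ 0ℚ)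
    where

    Identity : ℕ → ℕ → Set
    Identity q d = ℓ (d ℕ.+ q) * W w q d ≡ δ₀ q d + W↑ u q d + conv u w q d

    ℓ-raise : ∀ q d → suc (d ℕ.+ q) ≤ N → Identity q d →
      ℓ (suc (d ℕ.+ q)) * W w q d ≡ h w q (suc d) * W u q d + conv u w q d - W↘ u q d
    ℓ-raise q d b IH = begin
      ℓ′ * Wʷ
        ≡⟨ solve 3 (λ ℓ′ ℓ W → ℓ′ :* W := ℓ :* W :+ (ℓ′ :- ℓ) :* W) refl ℓ′ ℓ₀ Wʷ ⟩
      ℓ₀ * Wʷ + (ℓ′ - ℓ₀) * Wʷ
        ≡⟨ cong₂ _+_ IH (ℓ-step q d) ⟩
      (δ + L + C) + (h′ - hᵘ) * Wᵘ
        ≡⟨ solve 4 (λ S h′ hᵘ Wᵘ → S :+ (h′ :- hᵘ) :* Wᵘ := S :+ h′ :* Wᵘ :- hᵘ :* Wᵘ) refl (δ + L + C) h′ hᵘ Wᵘ ⟩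
      (δ + L + C) + h′ * Wᵘ - hᵘ * Wᵘ
        ≡⟨ cong (λ t → (δ + L + C) + h′ * Wᵘ - t) (W-recurrence u q d (nz-u q d b)) ⟩
      (δ + L + C) + h′ * Wᵘ - (δ + L + W↘ u q d)
        ≡⟨ solve 5 (λ δ L C hW R → δ :+ L :+ C :+ hW :- (δ :+ L :+ R) := hW :+ C :- R) refl δ L C (h′ * Wᵘ) (W↘ u q d) ⟩
      h′ * Wᵘ + C - W↘ u q d ∎
      where
      ℓ′ = ℓ (suc (d ℕ.+ q))
      ℓ₀ = ℓ (d ℕ.+ q)
      Wʷ = W w q d
      Wᵘ = W u q d
      h′ = h w q (suc d)
      hᵘ = h u q d
      δ = δ₀ q d
      L = W↑ u q d
      C = conv u w q d

    identity : ∀ q d → d ℕ.+ q ≤ N → Identity q d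
    identity zero zero b = trans (cong (_* W w 0 0) ℓ-origin) (W-recurrence w 0 0 (nz-w 0 0 b))
    identity zero (suc d) b = *-cancelˡ H H≢0 (begin
      H * (ℓ′ * W w 0 (suc d))   ≡⟨ W-recurrence-scaled ℓ′ w 0 (suc d) H≢0 ⟩
      ℓ′ * (0ℚ + W w 0 d + 0ℚ)   ≡⟨ solve 2 (λ ℓ W → ℓ :* (con 0ℚ :+ W :+ con 0ℚ) := ℓ :* W) refl ℓ′ (W w 0 d) ⟩
      ℓ′ * W w 0 d               ≡⟨ ℓ-raise 0 d b (identity 0 d (ℕP.<⇒≤ b)) ⟩
      H * W u 0 d + 0ℚ - 0ℚ
        ≡⟨ solve 2 (λ H W → H :* W :+ con 0ℚ :- con 0ℚ := H :* (con 0ℚ :+ W :+ con 0ℚ)) refl H (W u 0 d) ⟩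
      H * (0ℚ + W u 0 d + 0ℚ) ∎)
      where
      H = h w 0 (suc d)
      H≢0 = nz-w 0 (suc d) b
      ℓ′ = ℓ (suc (d ℕ.+ 0))
    identity (suc q) zero b = *-cancelˡ H H≢0 (begin
      H * (ℓ′ * W w (suc q) 0)       ≡⟨ W-recurrence-scaled ℓ′ w (suc q) 0 H≢0 ⟩
      ℓ′ * (0ℚ + 0ℚ + W w q 1)       ≡⟨ solve 2 (λ ℓ W → ℓ :* (con 0ℚ :+ con 0ℚ :+ W) := ℓ :* W) refl ℓ′ (W w q 1) ⟩
      ℓ′ * W w q 1                   ≡⟨ identity q 1 b ⟩
      0ℚ + W u q 0 + conv u w q 1    ≡⟨ cong (_+ conv u w q 1) (+-identityˡ (W u q 0)) ⟩
      W u q 0 + conv u w q 1         ≡⟨ conv-recurrence-zero u w q H≢0 ⟨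
      H * conv u w (suc q) 0         ≡⟨ solve 2 (λ H C → H :* C := H :* (con 0ℚ :+ con 0ℚ :+ C)) refl H C₀ ⟩
      H * (0ℚ + 0ℚ + conv u w (suc q) 0) ∎)
      where
      H = h w (suc q) 0
      H≢0 = nz-w (suc q) 0 b
      ℓ′ = ℓ (suc q)
      C₀ = conv u w (suc q) 0
    identity (suc q) (suc d) b = *-cancelˡ H H≢0 (begin
      H * (ℓ′ * W w (suc q) (suc d))
        ≡⟨ W-recurrence-scaled ℓ′ w (suc q) (suc d) H≢0 ⟩
      ℓ′ * (0ℚ + W w (suc q) d + W w q (suc (suc d)))
        ≡⟨ solve 3 (λ ℓ a b → ℓ :* (con 0ℚ :+ a :+ b) := ℓ :* a :+ ℓ :* b) refl ℓ′ (W w (suc q) d) W₂ ⟩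
      ℓ′ * W w (suc q) d + ℓ′ * W₂
        ≡⟨ cong₂ _+_ (ℓ-raise (suc q) d b (identity (suc q) d (ℕP.<⇒≤ b))) diagonal ⟩
      (H * W u (suc q) d + C₁ - W u q (suc d)) + (0ℚ + W u q (suc d) + C₂)
        ≡⟨ solve 4 (λ HW C₁ R C₂ → HW :+ C₁ :- R :+ (con 0ℚ :+ R :+ C₂) := HW :+ (C₁ :+ C₂))
             refl (H * W u (suc q) d) C₁ (W u q (suc d)) C₂ ⟩
      H * W u (suc q) d + (C₁ + C₂)
        ≡⟨ cong (H * W u (suc q) d +_) (conv-recurrence-suc u w q d H≢0) ⟨
      H * W u (suc q) d + H * C
        ≡⟨ solve 3 (λ H a b → H :* a :+ H :* b := H :* (con 0ℚ :+ a :+ b)) refl H (W u (suc q) d) C ⟩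
      H * (0ℚ + W u (suc q) d + C) ∎)
      where
      H = h w (suc q) (suc d)
      H≢0 = nz-w (suc q) (suc d) b
      ℓ′ = ℓ (suc (d ℕ.+ suc q))
      C = conv u w (suc q) (suc d)
      C₁ = conv u w (suc q) d
      C₂ = conv u w q (suc (suc d))
      W₂ = W w q (suc (suc d))
      diagonal : ℓ′ * W₂ ≡ 0ℚ + W u q (suc d) + C₂
      diagonal = trans (cong (λ p → ℓ (suc p) * W₂) (ℕP.+-suc d q))
                       (identity q (suc (suc d)) (subst (λ p → suc p ≤ N) (ℕP.+-suc d q) b))

    ℓ*W≡conv : ∀ m → suc m ≤ N → ℓ (suc m) * W w (suc m) 0 ≡ conv u w (suc m) 0
    ℓ*W≡conv m b = trans (identity (suc m) 0 b) (+-identityˡ _)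

  -- The common shape of Ĝaux (s w = w) and Ǧaux (s w = w + x); the first argument of X is fuel.
  module ConvolutionFamily
    (X : ℕ → ℕ → ℚ → Frac) (s : ℚ → ℚ) (divisor : ℚ → ℕ → ℚ)
    (X-one : ∀ f w → X (suc f) 1 w ≡ (1ℚ , 1ℚ - w))
    (X-suc : ∀ f m w → X (suc f) (suc (suc m)) w
                         ≡ sumFrom1 (suc m) (λ k → X f k (s w) ⊗ X f (suc (suc m) ∸ k) (w + ℕ→ℚ k * z)) ⊘ divisor w m)
    (s-nondegenerate : ∀ w N → Nondegenerate w (suc N) → Nondegenerate (s w) N)
    (divisor*W : ∀ w m → Nondegenerate w (suc m) → divisor w m * W w (suc m) 0 ≡ conv (s w) w (suc m) 0)
    (divisor-vanishes : ∀ w m d → d ≤ suc m → h w 0 d ≡ 0ℚ → divisor w m ≡ 0ℚ ⊎ ∃[ d′ ] (d′ ≤ m × h (s w) 0 d′ ≡ 0ℚ))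
    where

    summand : ℕ → ℕ → ℚ → ℕ → Frac
    summand f m w k = X f k (s w) ⊗ X f (suc (suc m) ∸ k) (w + ℕ→ℚ k * z)

    X-represents : ∀ f n w → suc n ≤ f → Nondegenerate w n → X f (suc n) w represents W w n 0
    X-represents (suc f) zero w _ nz =
      subst (_represents W w 0 0) (sym (X-one f w)) (cross-multiplied (W-origin w (nz 0 0 z≤n)))
    X-represents (suc f) (suc m) w (s≤s 1+m≤f) nz =
      subst (_represents W w (suc m) 0) (sym (X-suc f m w))
        (⊘-represents (divisor w m)
          (subst (sumFrom1 (suc m) F represents_) (sumFrom1ℚ-antidiagonal m T)
            (sumFrom1-represents (suc m) F (λ k → T k (suc m ∸ k)) F-represents))
          (divisor*W w m nz))
      where
      F = summand f m w
      T : ℕ → ℕ → ℚ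
      T k j = W (s w) (ℕ.pred k) 0 * W (w + ℕ→ℚ k * z) j 0
      F-represents : ∀ k → 1 ≤ k → k ≤ suc m → F k represents T k (suc m ∸ k)
      F-represents (suc k) _ (s≤s k≤m) =
        ⊗-represents
          (X-represents f k (s w) (ℕP.≤-trans (s≤s k≤m) 1+m≤f)
            (Nondegenerate-mono {s w} k≤m (s-nondegenerate w m nz)))
          (subst (λ i → X f i w′ represents W w′ (m ∸ k) 0) (sym (ℕP.+-∸-assoc 1 k≤m))
            (X-represents f (m ∸ k) w′ (ℕP.≤-trans (s≤s (ℕP.m∸n≤m m k)) 1+m≤f)
              (Nondegenerate-+z w (suc m) (suc k) (m ∸ k) (s≤s (ℕP.≤-reflexive (ℕP.m+[n∸m]≡n k≤m))) nz)))
        where w′ = w + ℕ→ℚ (suc k) * z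

    summand-den-vanishes : ∀ f m w k → 1 ≤ k → k ≤ suc m →
      den (summand f m w k) ≡ 0ℚ → den (X (suc f) (suc (suc m)) w) ≡ 0ℚ
    summand-den-vanishes f m w k 1≤k k≤1+m summand≡0 =
      trans (cong den (X-suc f m w))
            (*-vanishesˡ (divisor w m) (sumFrom1-den-vanishes (suc m) (summand f m w) k 1≤k k≤1+m summand≡0))

    X-den-vanishes : ∀ f n w q d → suc n ≤ f → d ℕ.+ q ≤ n → h w q d ≡ 0ℚ → den (X f (suc n) w) ≡ 0ℚ
    X-den-vanishes (suc f) zero w zero zero _ _ h≡0 = trans (cong den (X-one f w)) (trans (sym (h-origin w)) h≡0)
    X-den-vanishes (suc f) zero w zero (suc d) _ () _
    X-den-vanishes (suc f) zero w (suc q) d _ b _ = contradiction (subst (_≤ 0) (ℕP.+-suc d q) b) λ ()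
    X-den-vanishes (suc f) (suc m) w zero d (s≤s 1+m≤f) b h≡0 with divisor-vanishes w m d (ℕP.m+n≤o⇒m≤o d b) h≡0
    ... | inj₁ divisor≡0 =
      trans (cong den (X-suc f m w)) (*-vanishesʳ (den (sumFrom1 (suc m) (summand f m w))) divisor≡0)
    ... | inj₂ (d′ , d′≤m , h′≡0) =
      summand-den-vanishes f m w (suc m) (s≤s z≤n) ℕP.≤-refl
        (*-vanishesˡ (den (X f (suc m ∸ m) (w + ℕ→ℚ (suc m) * z)))
          (X-den-vanishes f m (s w) 0 d′ 1+m≤f (subst (_≤ m) (sym (ℕP.+-identityʳ d′)) d′≤m) h′≡0))
    X-den-vanishes (suc f) (suc m) w (suc q) d (s≤s 1+m≤f) b h≡0 =
      summand-den-vanishes f m w (suc q) (s≤s z≤n) (ℕP.m+n≤o⇒n≤o d b)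
        (*-vanishesʳ (den (X f (suc q) (s w)))
          (subst (λ i → den (X f i w′) ≡ 0ℚ) (sym (ℕP.+-∸-assoc 1 q≤m))
            (X-den-vanishes f (m ∸ q) w′ 0 d (ℕP.≤-trans (s≤s (ℕP.m∸n≤m m q)) 1+m≤f) d+0≤m∸q h′≡0)))
      where
      w′ = w + ℕ→ℚ (suc q) * z
      d+q≤m : d ℕ.+ q ≤ m
      d+q≤m = ℕP.≤-pred (subst (_≤ suc m) (ℕP.+-suc d q) b)
      q≤m : q ≤ m
      q≤m = ℕP.m+n≤o⇒n≤o d d+q≤m
      d+0≤m∸q : d ℕ.+ 0 ≤ m ∸ q
      d+0≤m∸q = subst (_≤ m ∸ q) (sym (ℕP.+-identityʳ d)) (ℕP.m+n≤o⇒m≤o∸n d d+q≤m)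
      h′≡0 : h w′ 0 d ≡ 0ℚ
      h′≡0 = trans (h-+z w (suc q) 0 d) (trans (cong (λ p → h w (suc p) d) (ℕP.+-identityʳ q)) h≡0)

    X-nondegenerate : ∀ f n w → suc n ≤ f → den (X f (suc n) w) ≢ 0ℚ → Nondegenerate w n
    X-nondegenerate f n w 1+n≤f den≢0 q d b h≡0 = den≢0 (X-den-vanishes f n w q d 1+n≤f b h≡0)

  [p-p]*q≡0 : ∀ p q → (p - p) * q ≡ 0ℚ
  [p-p]*q≡0 = solve 2 (λ p q → (p :- p) :* q := con 0ℚ) refl

  Ǧ-divisor*W : ∀ w m → Nondegenerate w (suc m) → (1ℚ - w) * W w (suc m) 0 ≡ conv (w + x) w (suc m) 0
  Ǧ-divisor*W w m nz =
    trans (cong (_* W w (suc m) 0) (sym (h-origin w)))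
          (ConvolutionIdentity.ℓ*W≡conv (w + x) w (λ _ → h w 0 0) (suc m) refl ℓ-step nz nz-u m ℕP.≤-refl)
    where
    ℓ-step : ∀ q d → (h w 0 0 - h w 0 0) * W w q d ≡ (h w q (suc d) - h (w + x) q d) * W (w + x) q d
    ℓ-step q d = begin
      (h w 0 0 - h w 0 0) * W w q d                    ≡⟨ [p-p]*q≡0 (h w 0 0) (W w q d) ⟩
      0ℚ                                               ≡⟨ [p-p]*q≡0 (h w q (suc d)) (W (w + x) q d) ⟨
      (h w q (suc d) - h w q (suc d)) * W (w + x) q d  ≡⟨ cong (λ t → (h w q (suc d) - t) * W (w + x) q d) (h-+x w q d) ⟨
      (h w q (suc d) - h (w + x) q d) * W (w + x) q d  ∎
    nz-u : ∀ q d → suc (d ℕ.+ q) ≤ suc m → h (w + x) q d ≢ 0ℚ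
    nz-u q d b h≡0 = nz q (suc d) b (trans (sym (h-+x w q d)) h≡0)

  Ǧ-divisor-vanishes : ∀ w m d → d ≤ suc m → h w 0 d ≡ 0ℚ → 1ℚ - w ≡ 0ℚ ⊎ ∃[ d′ ] (d′ ≤ m × h (w + x) 0 d′ ≡ 0ℚ)
  Ǧ-divisor-vanishes w m zero    _           h≡0 = inj₁ (trans (sym (h-origin w)) h≡0)
  Ǧ-divisor-vanishes w m (suc d) (s≤s d≤m) h≡0 = inj₂ (d , d≤m , trans (h-+x w 0 d) h≡0)

  Ĝ-divisor*W : ∀ w m → Nondegenerate w (suc m) →
    (1ℚ - w - ℕ→ℚ (suc m) * x) * W w (suc m) 0 ≡ conv w w (suc m) 0
  Ĝ-divisor*W w m nz =
    trans (cong (_* W w (suc m) 0) (sym (h-axis w (suc m))))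
          (ConvolutionIdentity.ℓ*W≡conv w w (h w 0) (suc m) refl ℓ-step nz (λ q d b → nz q d (ℕP.<⇒≤ b)) m ℕP.≤-refl)
    where
    ℓ-step : ∀ q d → (h w 0 (suc (d ℕ.+ q)) - h w 0 (d ℕ.+ q)) * W w q d ≡ (h w q (suc d) - h w q d) * W w q d
    ℓ-step q d = cong (_* W w q d) (trans (h-suc-d w 0 (d ℕ.+ q)) (sym (h-suc-d w q d)))

  Ĝ-divisor-vanishes : ∀ w m d → d ≤ suc m → h w 0 d ≡ 0ℚ →
    1ℚ - w - ℕ→ℚ (suc m) * x ≡ 0ℚ ⊎ ∃[ d′ ] (d′ ≤ m × h w 0 d′ ≡ 0ℚ)
  Ĝ-divisor-vanishes w m d d≤1+m h≡0 with ℕP.m≤n⇒m<n∨m≡n d≤1+m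
  ... | inj₁ (s≤s d≤m) = inj₂ (d , d≤m , h≡0)
  ... | inj₂ refl      = inj₁ (trans (sym (h-axis w (suc m))) h≡0)

  module Ĝ-family = ConvolutionFamily (λ f n w → Ĝaux f n w x z) (λ w → w) (λ w m → 1ℚ - w - ℕ→ℚ (suc m) * x)
    (λ _ _ → refl) (λ _ _ _ → refl) (λ w N → Nondegenerate-mono {w} (ℕP.n≤1+n N)) Ĝ-divisor*W Ĝ-divisor-vanishes

  module Ǧ-family = ConvolutionFamily (λ f n w → Ǧaux f n w x z) (_+ x) (λ w _ → 1ℚ - w)
    (λ _ _ → refl) (λ _ _ _ → refl) Nondegenerate-+x Ǧ-divisor*W Ǧ-divisor-vanishes

theorem1p4 : (n : ℕ) → 1 ≤ n → (w x z : ℚ) → Ĝ n w x z ≈F Ǧ n w x z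
theorem1p4 (suc n) _ w x z =
  ≈F-by-nondegeneracy (Ĝ (suc n) w x z) (Ǧ (suc n) w x z)
    (Ĝ-family.X-nondegenerate (suc n) n w ℕP.≤-refl)
    (Ǧ-family.X-nondegenerate (suc n) n w ℕP.≤-refl)
    (Ĝ-family.X-represents (suc n) n w ℕP.≤-refl)
    (Ǧ-family.X-represents (suc n) n w ℕP.≤-refl)
  where open LatticePaths x z
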